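{- Let $\sigma$ be a finite relational vocabulary with maximum arity $n$ and $k \ge n$. The relation $\to^{\mathbb{Z}}_k$ on finite $\sigma$-structures is transitive: for all finite $\sigma$-structures $A, B, C$, if $A \to^{\mathbb{Z}}_k B$ and $B \to^{\mathbb{Z}}_k C$ then $A \to^{\mathbb{Z}}_k C$.
   Context: Structures are identified with universes. For structures $X, Y$: $S_k(X)$ is the poset of subsets of $X$ of size at most $k$ (induced substructures), $M_k(X)$ its set of maximal elements; $H_k = H_k(X,Y) : S_k(X)^{op}\to\mathbf{Set}$ sends $D$ to the set of homomorphisms $D \to Y$, with restriction maps $\rho^D_{D'}(h) = h|_{D'}$. A subpresheaf is flasque if its restriction maps are surjective; $P^{\Diamond}$ is the largest flasque subpresheaf of a presheaf $P$. For a set $X$, $\mathbb{Z}^{(X)}$ is the free abelian group on $X$, and $\mathbb{Z}^{(f)}(\sum r_i x_i) = \sum r_i f(x_i)$. For a flasque subpresheaf $P$ of $H_k$ and $p \in P(D_0)$, $D_0\in M_k(X)$, $\mathbb{Z}\text{ -test}(P,p)$ holds iff there is $\{\alpha_D\}_{D \in M_k(X)}$, $\alpha_D\in\mathbb{Z}^{(P(D))}$, with $\mathbb{Z}^{(\rho^D_{D\cap D'})}(\alpha_D)=\mathbb{Z}^{(\rho^{D'}_{D\cap D'})}(\alpha_{D'})$ for all $D,D'\in M_k(X)$ and $\alpha_{D_0} = 1\cdot p$. $P^{\Box}(D) = \{p\in P(D) : \mathbb{Z}\text{ -test}(P,p)\}$ for $D\in M_k(X)$, $P^{\Box}(D) =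 P(D)$ otherwise. Set $S^{(0)} = H_k^{\Diamond}$, $S^{(m+1)} = ((S^{(m)})^{\Box})^{\Diamond}$; this decreasing sequence stabilizes at $S^{(*)}$. $X \to^{\mathbb{Z}}_k Y$ means $S^{(*)}$ (computed for $H_k(X,Y)$) is non-empty, i.e. $S^{(*)}(D) \ne \emptyset$ for some $D$. -}

module Defs where

open import Data.Nat using (ℕ; zero; suc; _≤_; _⊔_)
open import Data.Integer using (ℤ; 0ℤ; 1ℤ; _+_)
open import Data.Fin using (Fin; zero; suc)
open import Data.Fin.Properties using () renaming (_≟_ to _≟ᶠ_)
open import Data.Fin.Subset using (Subset; _⊆_; _∩_; ∣_∣)
open import Data.Bool using (Bool; true; false; T; if_then_else_)
open import Data.Maybe using (Maybe; just; nothing; is-just)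
import Data.Maybe.Properties as MP
open import Data.Vec using (Vec; []; _∷_; map; zipWith; lookup)
import Data.Vec.Properties as VP
open import Data.List using (List; []; _∷_; concatMap; allFin; foldr)
import Data.List as L
open import Data.Product using (Σ; ∃; _×_; _,_)
open import Relation.Binary.PropositionalEquality using (_≡_; _≢_)
open import Relation.Nullary using (Dec; yes; no)
open import Relation.Binary using (DecidableEquality)

record Vocabulary : Set where
  field
    nsym  : ℕ
    arity : Fin nsym → ℕ
open Vocabulary public

maxOf : (r : ℕ) → (Fin r → ℕ) → ℕ
maxOf zero    a = 0
maxOf (suc r) a = a zero ⊔ maxOf r (λ i → a (suc i))

maxArity : Vocabulary → ℕ
maxArity σ = maxOf (nsym σ) (arity σ)

record Structure (σ : Vocabulary) (N : ℕ) : Set where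
  field
    rel : (R : Fin (nsym σ)) → Vec (Fin N) (arity σ R) → Bool
open Structure public

-- Partial maps Fin N ⇀ Fin M.  A partial map h with domain D encodes a
-- map D → Fin M; D = dom h.

PMap : ℕ → ℕ → Set
PMap N M = Vec (Maybe (Fin M)) N

dom : ∀ {N M} → PMap N M → Subset N
dom h = map is-just h

-- restriction of h to E (only meaningful for E ⊆ dom h): h|_E
restrict : ∀ {N M} → PMap N M → Subset N → PMap N M
restrict h E = zipWith (λ x b → if b then x else nothing) h E

_≟ᵖ_ : ∀ {N M} → DecidableEquality (PMap N M)
_≟ᵖ_ = VP.≡-dec (MP.≡-dec _≟ᶠ_)

allPMaps : (N M : ℕ) → List (PMap N M)
allPMaps zero    M = [] ∷ []
allPMaps (suc N) M =
  concatMap (λ v → L.map (_∷ v) (nothing ∷ L.map just (allFin M))) (allPMaps N M)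

-- Homomorphisms from the induced substructure X[dom h] to Y

IsHom : ∀ {σ N M} → Structure σ N → Structure σ M → PMap N M → Set
IsHom {σ} X Y h =
  (R : Fin (nsym σ)) (t : Vec (Fin _) (arity σ R)) (u : Vec (Fin _) (arity σ R)) →
  map (lookup h) t ≡ map just u →       -- all entries of t lie in dom h, and h ∘ t = u
  rel X R t ≡ true → rel Y R u ≡ true

InS : ∀ {N} → ℕ → Subset N → Set
InS k D = ∣ D ∣ ≤ k

IsMax : ∀ {N} → ℕ → Subset N → Set
IsMax k D = InS k D × (∀ E → D ⊆ E → InS k E → E ≡ D)

-- Families of sets of homomorphisms.  A family P : PMap N M → Set
-- represents D ↦ P(D) = { h | dom h ≡ D , P h }.

Family : ℕ → ℕ → Set₁
Family N M = PMap N M → Set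

Hk : ∀ {σ N M} → ℕ → Structure σ N → Structure σ M → Family N M
Hk k X Y h = InS k (dom h) × IsHom X Y h

IsSubPresheaf : ∀ {N M} → (PMap N M → Bool) → Family N M → Set
IsSubPresheaf Q P =
  (∀ h → T (Q h) → P h) ×
  (∀ h E → E ⊆ dom h → T (Q h) → T (Q (restrict h E)))

IsFlasque : ∀ {N M} → ℕ → (PMap N M → Bool) → Set
IsFlasque k Q =
  ∀ g D → InS k D → dom g ⊆ D → T (Q g) →
  ∃ λ h → dom h ≡ D × T (Q h) × restrict h (dom g) ≡ g

-- P^◇ : the largest flasque subpresheaf, i.e. the union of all flasque
-- subpresheaves of P (subsets of the finite sets P(D) are given by
-- characteristic functions).
◇ : ∀ {N M} → ℕ → Family N M → Family N M
◇ k P h = Σ (PMap _ _ → Bool) λ Q → IsSubPresheaf Q P × IsFlasque k Q × T (Q h)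

-- ℤ^{(ρ)} applied to α (given by coefficient function c), evaluated at g:
-- the coefficient of g in Σ_h c(h) · h|_E
push : ∀ {N M} → (PMap N M → ℤ) → Subset N → PMap N M → ℤ
push {N} {M} c E g =
  foldr (λ h s → (if Dec.does (restrict h E ≟ᵖ g) then c h else 0ℤ) + s) 0ℤ (allPMaps N M)

-- Z-test(P, p), where D₀ = dom p.  α_D ∈ ℤ^{(P(D))} is encoded by a
-- coefficient function α D supported on P(D).
ZTest : ∀ {N M} → ℕ → Family N M → PMap N M → Set
ZTest {N} {M} k P p =
  Σ (Subset N → PMap N M → ℤ) λ α →
    (∀ D → IsMax k D → ∀ h → α D h ≢ 0ℤ → dom h ≡ D × P h) ×
    (∀ D D' → IsMax k D → IsMax k D' → ∀ g →
       push (α D) (D ∩ D') g ≡ push (α D') (D ∩ D') g) ×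
    (∀ h → α (dom p) h ≡ (if Dec.does (h ≟ᵖ p) then 1ℤ else 0ℤ))

□ : ∀ {N M} → ℕ → Family N M → Family N M
□ k P h = P h × (IsMax k (dom h) → ZTest k P h)

Sm : ∀ {σ N M} → ℕ → Structure σ N → Structure σ M → ℕ → Family N M
Sm k X Y zero    = ◇ k (Hk k X Y)
Sm k X Y (suc m) = ◇ k (□ k (Sm k X Y m))

-- S^{(*)} : the stable value of the decreasing sequence, i.e. its intersection
Sstar : ∀ {σ N M} → ℕ → Structure σ N → Structure σ M → Family N M
Sstar k X Y h = ∀ m → Sm k X Y m h

_→ℤ[_]_ : ∀ {σ N M} → Structure σ N → ℕ → Structure σ M → Set
X →ℤ[ k ] Y = ∃ λ h → Sstar k X Y h

module Submission where

-- By induction on m, composition (g ∘ f with img f ⊆ dom g) maps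
-- S^(m)(A,B) × S^(m)(B,C) into S^(m)(A,C).  For ◇, the composites of two
-- flasque subpresheaves form a flasque subpresheaf: extend f first, then
-- extend g restricted to img f over the new image, which still has at most
-- k points.  For □, a Z-test witness α for f and a witness β for an extension
-- of g to a maximal set containing img f give the witness
--   γ_D = ∑_{f'} α_D(f') · ∑_{g'} β_{img f'}(g') · (g' ∘ f'),
-- where β is first extended to every set of size ≤ k by restricting from a
-- maximal superset (well defined by compatibility of β).  This construction
-- commutes with restriction, so γ inherits compatibility from α.  Finally each
-- S^(m) is closed under restriction, so it contains the empty map as soon as
-- it is non-empty, and the empty map composes with anything.

open import Defs
open import Data.Nat as ℕ using (ℕ; zero; suc; _≤_; _∸_; z≤n; s≤s)
import Data.Nat.Properties as ℕₚ
open import Data.Integer using (ℤ; 0ℤ; 1ℤ; _+_; _*_)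
import Data.Integer.Properties as ℤₚ
open import Algebra.Properties.CommutativeSemigroup ℤₚ.+-commutativeSemigroup using (interchange)
open import Data.Fin using (Fin; zero; suc)
import Data.Fin.Properties as Finₚ
open import Data.Fin.Subset using (Subset; _⊆_; _∩_; _∪_; ⁅_⁆; ∣_∣; _∈_; ⊤) renaming (⊥ to ∅)
open import Data.Fin.Subset.Properties
open import Data.Bool using (Bool; true; false; T; if_then_else_; _∧_)
open import Data.Maybe using (Maybe; just; nothing; is-just; _>>=_)
import Data.Maybe.Properties as Maybeₚ
open import Data.Vec using (Vec; []; _∷_; lookup)
import Data.Vec as Vec
import Data.Vec.Properties as Vecₚ
open import Data.List using (List; []; _∷_; concatMap; allFin; foldr; tabulate; _++_)
import Data.List as List
import Data.List.Properties as Listₚ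
open import Data.List.Relation.Unary.Any as Any using (Any; here; there; any?)
open import Data.Product using (∃; _×_; _,_; proj₁; proj₂)
open import Data.Sum using (_⊎_; inj₁; inj₂)
open import Data.Empty using (⊥-elim)
open import Function using (_∘_; id; mk⇔)
open import Function.Definitions using (Injective)
open import Relation.Binary using (DecidableEquality)
open import Relation.Binary.PropositionalEquality
open import Relation.Nullary using (Dec; yes; no; does; isYes)
open import Relation.Nullary.Decidable
  using (_×-dec_; T?; toWitness; fromWitness; dec-true; dec-false; does-⇔)

private variable N M NA NB NC : ℕ

infixr 8 ⟦_⟧*_
infix 5 sumOver

⟦_⟧*_ : Bool → ℤ → ℤ
⟦ b ⟧* x = if b then x else 0ℤ

sumOver : {X : Set} → List X → (X → ℤ) → ℤ
sumOver l F = foldr (λ x s → F x + s) 0ℤ l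

syntax sumOver l (λ x → e) = ∑[ x ∈ l ] e

module _ {X : Set} where

  sum-cong : ∀ (l : List X) {F G : X → ℤ} → (∀ x → F x ≡ G x) → sumOver l F ≡ sumOver l G
  sum-cong []      F≗G = refl
  sum-cong (x ∷ l) F≗G = cong₂ _+_ (F≗G x) (sum-cong l F≗G)

  sum-zero : ∀ (l : List X) {F : X → ℤ} → (∀ x → F x ≡ 0ℤ) → sumOver l F ≡ 0ℤ
  sum-zero []      F≗0 = refl
  sum-zero (x ∷ l) F≗0 = cong₂ _+_ (F≗0 x) (sum-zero l F≗0)

  sum-+ : ∀ (l : List X) (F G : X → ℤ) → ∑[ x ∈ l ] (F x + G x) ≡ sumOver l F + sumOver l G
  sum-+ []      F G = refl
  sum-+ (x ∷ l) F G =
    trans (cong (F x + G x +_) (sum-+ l F G)) (interchange (F x) (G x) (sumOver l F) (sumOver l G))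

  sum-*ˡ : ∀ (l : List X) a (F : X → ℤ) → ∑[ x ∈ l ] a * F x ≡ a * sumOver l F
  sum-*ˡ []      a F = sym (ℤₚ.*-zeroʳ a)
  sum-*ˡ (x ∷ l) a F =
    trans (cong (a * F x +_) (sum-*ˡ l a F)) (sym (ℤₚ.*-distribˡ-+ a (F x) (sumOver l F)))

  sum-*ʳ : ∀ (l : List X) a (F : X → ℤ) → ∑[ x ∈ l ] F x * a ≡ sumOver l F * a
  sum-*ʳ l a F =
    trans (sum-cong l (λ x → ℤₚ.*-comm (F x) a)) (trans (sum-*ˡ l a F) (ℤₚ.*-comm a _))

  sum-++ : ∀ (l l' : List X) (F : X → ℤ) → sumOver (l ++ l') F ≡ sumOver l F + sumOver l' F
  sum-++ []      l' F = sym (ℤₚ.+-identityˡ _)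
  sum-++ (x ∷ l) l' F = trans (cong (F x +_) (sum-++ l l' F)) (sym (ℤₚ.+-assoc (F x) _ _))

  iverson-sum : ∀ (l : List X) b (F : X → ℤ) → ⟦ b ⟧* sumOver l F ≡ ∑[ x ∈ l ] ⟦ b ⟧* F x
  iverson-sum l true  F = refl
  iverson-sum l false F = sym (sum-zero l (λ _ → refl))

  sum≢0⇒Any : ∀ (l : List X) (F : X → ℤ) → sumOver l F ≢ 0ℤ → Any (λ x → F x ≢ 0ℤ) l
  sum≢0⇒Any []      F ne = ⊥-elim (ne refl)
  sum≢0⇒Any (x ∷ l) F ne with F x ℤₚ.≟ 0ℤ
  ... | no  Fx≢0 = here Fx≢0
  ... | yes Fx≡0 = there (sum≢0⇒Any l F (λ e → ne (cong₂ _+_ Fx≡0 e)))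

  sum-*≢0 : ∀ (l : List X) (a F : X → ℤ) → ∑[ x ∈ l ] a x * F x ≢ 0ℤ →
    ∃ λ x → a x ≢ 0ℤ × F x ≢ 0ℤ
  sum-*≢0 l a F ne with Any.satisfied (sum≢0⇒Any l (λ x → a x * F x) ne)
  ... | x , ax*Fx≢0 =
    x , (λ e → ax*Fx≢0 (cong (_* F x) e)) , (λ e → ax*Fx≢0 (trans (cong (a x *_) e) (ℤₚ.*-zeroʳ (a x))))

  sum-*-cong-on-support : ∀ (l : List X) (a F G : X → ℤ) → (∀ x → a x ≢ 0ℤ → F x ≡ G x) →
    ∑[ x ∈ l ] a x * F x ≡ ∑[ x ∈ l ] a x * G x
  sum-*-cong-on-support l a F G F≗G = sum-cong l pointwise
    where
    pointwise : ∀ x → a x * F x ≡ a x * G x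
    pointwise x with a x ℤₚ.≟ 0ℤ
    ... | yes ax≡0 = trans (cong (_* F x) ax≡0) (sym (cong (_* G x) ax≡0))
    ... | no  ax≢0 = cong (a x *_) (F≗G x ax≢0)

sum-swap : ∀ {X Y : Set} (l : List X) (l' : List Y) (F : X → Y → ℤ) →
  ∑[ x ∈ l ] (∑[ y ∈ l' ] F x y) ≡ ∑[ y ∈ l' ] (∑[ x ∈ l ] F x y)
sum-swap []      l' F = sym (sum-zero l' (λ _ → refl))
sum-swap (x ∷ l) l' F =
  trans (cong (sumOver l' (F x) +_) (sum-swap l l' F)) (sym (sum-+ l' (F x) (λ y → ∑[ x ∈ l ] F x y)))

sum-map : ∀ {X Y : Set} (g : X → Y) (l : List X) (F : Y → ℤ) → sumOver (List.map g l) F ≡ sumOver l (F ∘ g)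
sum-map g []      F = refl
sum-map g (x ∷ l) F = cong (F (g x) +_) (sum-map g l F)

sum-concatMap : ∀ {X Y : Set} (g : X → List Y) (l : List X) (F : Y → ℤ) →
  sumOver (concatMap g l) F ≡ ∑[ x ∈ l ] sumOver (g x) F
sum-concatMap g []      F = refl
sum-concatMap g (x ∷ l) F =
  trans (sum-++ (g x) (concatMap g l) F) (cong (sumOver (g x) F +_) (sum-concatMap g l F))

iverson-comm : ∀ b c x → ⟦ b ⟧* ⟦ c ⟧* x ≡ ⟦ c ⟧* ⟦ b ⟧* x
iverson-comm true  c     x = refl
iverson-comm false true  x = refl
iverson-comm false false x = refl

iverson-∧ : ∀ b c x → ⟦ b ∧ c ⟧* x ≡ ⟦ c ⟧* ⟦ b ⟧* x
iverson-∧ true  c     x = refl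
iverson-∧ false true  x = refl
iverson-∧ false false x = refl

iverson-*ˡ : ∀ b a x → ⟦ b ⟧* (a * x) ≡ a * ⟦ b ⟧* x
iverson-*ˡ true  a x = refl
iverson-*ˡ false a x = sym (ℤₚ.*-zeroʳ a)

iverson-*ʳ : ∀ b x y → ⟦ b ⟧* x * y ≡ ⟦ b ⟧* (x * y)
iverson-*ʳ true  x y = refl
iverson-*ʳ false x y = refl

iverson-1-* : ∀ b x → ⟦ b ⟧* 1ℤ * x ≡ ⟦ b ⟧* x
iverson-1-* true  x = ℤₚ.*-identityˡ x
iverson-1-* false x = refl

iverson≢0 : ∀ {P : Set} (P? : Dec P) x → ⟦ does P? ⟧* x ≢ 0ℤ → P × x ≢ 0ℤ
iverson≢0 (yes p) x x≢0 = p , x≢0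
iverson≢0 (no ¬p) x 0≢0 = ⊥-elim (0≢0 refl)

module _ {A : Set} (_≟_ : DecidableEquality A) where

  Enumerates : List A → Set
  Enumerates l = ∀ (F : A → ℤ) a → ∑[ x ∈ l ] ⟦ does (x ≟ a) ⟧* F x ≡ F a

  does-≟-sym : ∀ x y → does (x ≟ y) ≡ does (y ≟ x)
  does-≟-sym x y = does-⇔ (mk⇔ sym sym) (x ≟ y) (y ≟ x)

  enumerates-sym : ∀ l → Enumerates l → ∀ (F : A → ℤ) a → ∑[ x ∈ l ] ⟦ does (a ≟ x) ⟧* F x ≡ F a
  enumerates-sym l en F a =
    trans (sum-cong l (λ x → cong (⟦_⟧* F x) (does-≟-sym a x))) (en F a)

  enumerates-complete : ∀ l → Enumerates l → ∀ a → Any (a ≡_) l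
  enumerates-complete l en a =
    Any.map (λ {x} ne → sym (proj₁ (iverson≢0 (x ≟ a) 1ℤ ne)))
            (sum≢0⇒Any l _ (λ δ≡0 → 1≢0 (trans (sym (en (λ _ → 1ℤ) a)) δ≡0)))
    where
    1≢0 : 1ℤ ≢ 0ℤ
    1≢0 ()

  sum-δ-tabulate-∉ : ∀ {n} (f : Fin n → A) {a} → (∀ i → f i ≢ a) → ∀ (F : A → ℤ) →
    ∑[ x ∈ tabulate f ] ⟦ does (x ≟ a) ⟧* F x ≡ 0ℤ
  sum-δ-tabulate-∉ {zero}  f f≢a F = refl
  sum-δ-tabulate-∉ {suc n} f f≢a F =
    cong₂ (λ b s → ⟦ b ⟧* F (f zero) + s) (dec-false (f zero ≟ _) (f≢a zero))
          (sum-δ-tabulate-∉ (f ∘ suc) (f≢a ∘ suc) F)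

  sum-δ-tabulate : ∀ {n} (f : Fin n → A) → Injective _≡_ _≡_ f → ∀ (F : A → ℤ) i →
    ∑[ x ∈ tabulate f ] ⟦ does (x ≟ f i) ⟧* F x ≡ F (f i)
  sum-δ-tabulate f f-inj F zero =
    trans (cong₂ (λ b s → ⟦ b ⟧* F (f zero) + s) (dec-true (f zero ≟ f zero) refl)
                 (sum-δ-tabulate-∉ (f ∘ suc) (λ i e → Finₚ.0≢1+n (f-inj (sym e))) F))
          (ℤₚ.+-identityʳ _)
  sum-δ-tabulate f f-inj F (suc i) =
    trans (cong₂ (λ b s → ⟦ b ⟧* F (f zero) + s)
                 (dec-false (f zero ≟ f (suc i)) (λ e → Finₚ.0≢1+n (f-inj e)))
                 (sum-δ-tabulate (f ∘ suc) (λ e → Finₚ.suc-injective (f-inj e)) F i))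
          (ℤₚ.+-identityˡ _)

_≟ₘ_ : ∀ {M} → DecidableEquality (Maybe (Fin M))
_≟ₘ_ = Maybeₚ.≡-dec Finₚ._≟_

allMaybeFin : ∀ M → List (Maybe (Fin M))
allMaybeFin M = nothing ∷ List.map just (allFin M)

toMaybe : ∀ {M} → Fin (suc M) → Maybe (Fin M)
toMaybe zero    = nothing
toMaybe (suc i) = just i

toMaybe-injective : ∀ {M} → Injective _≡_ _≡_ (toMaybe {M})
toMaybe-injective {x = zero}  {zero}  _  = refl
toMaybe-injective {x = suc i} {suc j} eq = cong suc (Maybeₚ.just-injective eq)

allMaybeFin-enumerates : ∀ M → Enumerates _≟ₘ_ (allMaybeFin M)
allMaybeFin-enumerates M =
  subst (Enumerates _≟ₘ_) (sym (cong (nothing ∷_) (Listₚ.map-tabulate id just))) tabulate-enumerates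
  where
  tabulate-enumerates : Enumerates _≟ₘ_ (tabulate toMaybe)
  tabulate-enumerates F nothing  = sum-δ-tabulate _≟ₘ_ toMaybe toMaybe-injective F zero
  tabulate-enumerates F (just i) = sum-δ-tabulate _≟ₘ_ toMaybe toMaybe-injective F (suc i)

sum-allPMaps-suc : ∀ N M (F : PMap (suc N) M → ℤ) →
  sumOver (allPMaps (suc N) M) F ≡ ∑[ v ∈ allPMaps N M ] (∑[ x ∈ allMaybeFin M ] F (x ∷ v))
sum-allPMaps-suc N M F =
  trans (sum-concatMap _ (allPMaps N M) F) (sum-cong (allPMaps N M) (λ v → sum-map (_∷ v) (allMaybeFin M) F))

allPMaps-enumerates : ∀ N M → Enumerates _≟ᵖ_ (allPMaps N M)
allPMaps-enumerates zero    M F [] =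
  trans (cong (λ b → ⟦ b ⟧* F [] + 0ℤ) (dec-true (_≟ᵖ_ {0} {M} [] []) refl)) (ℤₚ.+-identityʳ _)
-- does ((x ∷ v) ≟ᵖ (y ∷ w)) reduces to does (x ≟ₘ y) ∧ does (v ≟ᵖ w).
allPMaps-enumerates (suc N) M F (y ∷ w) = begin
    ∑[ h ∈ allPMaps (suc N) M ] ⟦ does (h ≟ᵖ (y ∷ w)) ⟧* F h
  ≡⟨ sum-allPMaps-suc N M (λ h → ⟦ does (h ≟ᵖ (y ∷ w)) ⟧* F h) ⟩
    ∑[ v ∈ allPMaps N M ] (∑[ x ∈ allMaybeFin M ] ⟦ does (x ≟ₘ y) ∧ does (v ≟ᵖ w) ⟧* F (x ∷ v))
  ≡⟨ sum-cong (allPMaps N M) (λ v →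
       trans (sum-cong (allMaybeFin M) (λ x → iverson-∧ (does (x ≟ₘ y)) (does (v ≟ᵖ w)) _))
             (sym (iverson-sum (allMaybeFin M) (does (v ≟ᵖ w)) _))) ⟩
    ∑[ v ∈ allPMaps N M ] ⟦ does (v ≟ᵖ w) ⟧* (∑[ x ∈ allMaybeFin M ] ⟦ does (x ≟ₘ y) ⟧* F (x ∷ v))
  ≡⟨ allPMaps-enumerates N M _ w ⟩
    ∑[ x ∈ allMaybeFin M ] ⟦ does (x ≟ₘ y) ⟧* F (x ∷ w)
  ≡⟨ allMaybeFin-enumerates M (λ x → F (x ∷ w)) y ⟩
    F (y ∷ w) ∎
  where open ≡-Reasoning

allPMaps-enumerates-sym : ∀ N M (F : PMap N M → ℤ) p →
  ∑[ x ∈ allPMaps N M ] ⟦ does (p ≟ᵖ x) ⟧* F x ≡ F p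
allPMaps-enumerates-sym N M = enumerates-sym _≟ᵖ_ (allPMaps N M) (allPMaps-enumerates N M)

⊆⇒∩≡ : ∀ {n} {D E : Subset n} → E ⊆ D → D ∩ E ≡ E
⊆⇒∩≡ {D = D} {E} E⊆D = ⊆-antisym (p∩q⊆q D E) (λ x∈E → x∈p∩q⁺ (E⊆D x∈E , x∈E))

⊆∧∣∣≤⇒≡ : ∀ {n} {D E : Subset n} → D ⊆ E → ∣ E ∣ ≤ ∣ D ∣ → E ≡ D
⊆∧∣∣≤⇒≡ {D = D} {E} D⊆E ∣E∣≤∣D∣ = ⊆-antisym E⊆D D⊆E
  where
  E⊆D : E ⊆ D
  E⊆D {x} x∈E with x ∈? D
  ... | yes x∈D = x∈D
  ... | no  x∉D =
    ⊥-elim (ℕₚ.<-irrefl refl (ℕₚ.<-≤-trans (p⊂q⇒∣p∣<∣q∣ (D⊆E , x , x∈E , x∉D)) ∣E∣≤∣D∣))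

∣⁅x⁆∪p∣≤1+∣p∣ : ∀ {n} (x : Fin n) p → ∣ ⁅ x ⁆ ∪ p ∣ ≤ suc ∣ p ∣
∣⁅x⁆∪p∣≤1+∣p∣ zero    (b ∷ p)     =
  s≤s (ℕₚ.≤-trans (ℕₚ.≤-reflexive (cong ∣_∣ (∪-identityˡ p))) (∣p∣≤∣x∷p∣ b p))
∣⁅x⁆∪p∣≤1+∣p∣ (suc x) (true ∷ p)  = s≤s (∣⁅x⁆∪p∣≤1+∣p∣ x p)
∣⁅x⁆∪p∣≤1+∣p∣ (suc x) (false ∷ p) = ∣⁅x⁆∪p∣≤1+∣p∣ x p

addUpTo : ∀ {n} → ℕ → Subset n → Subset n
addUpTo zero    U           = U
addUpTo (suc b) []          = []
addUpTo (suc b) (true ∷ U)  = true ∷ addUpTo (suc b) U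
addUpTo (suc b) (false ∷ U) = true ∷ addUpTo b U

⊆-addUpTo : ∀ {n} b (U : Subset n) → U ⊆ addUpTo b U
⊆-addUpTo zero    U           = ⊆-refl
⊆-addUpTo (suc b) []          = ⊆-refl
⊆-addUpTo (suc b) (true ∷ U)  = in⊆in (⊆-addUpTo (suc b) U)
⊆-addUpTo (suc b) (false ∷ U) = out⊆ (⊆-addUpTo b U)

∣addUpTo∣≤ : ∀ {n} b (U : Subset n) → ∣ addUpTo b U ∣ ≤ ∣ U ∣ ℕ.+ b
∣addUpTo∣≤ zero    U           = ℕₚ.≤-reflexive (sym (ℕₚ.+-identityʳ _))
∣addUpTo∣≤ (suc b) []          = z≤n
∣addUpTo∣≤ (suc b) (true ∷ U)  = s≤s (∣addUpTo∣≤ (suc b) U)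
∣addUpTo∣≤ (suc b) (false ∷ U) =
  ℕₚ.≤-trans (s≤s (∣addUpTo∣≤ b U)) (ℕₚ.≤-reflexive (sym (ℕₚ.+-suc ∣ U ∣ b)))

addUpTo≡⊤⊎∣addUpTo∣≡ : ∀ {n} b (U : Subset n) →
  addUpTo b U ≡ ⊤ ⊎ ∣ addUpTo b U ∣ ≡ ∣ U ∣ ℕ.+ b
addUpTo≡⊤⊎∣addUpTo∣≡ zero    U           = inj₂ (sym (ℕₚ.+-identityʳ _))
addUpTo≡⊤⊎∣addUpTo∣≡ (suc b) []          = inj₁ refl
addUpTo≡⊤⊎∣addUpTo∣≡ (suc b) (true ∷ U)  with addUpTo≡⊤⊎∣addUpTo∣≡ (suc b) U
... | inj₁ ≡⊤ = inj₁ (cong (true ∷_) ≡⊤)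
... | inj₂ ≡+ = inj₂ (cong suc ≡+)
addUpTo≡⊤⊎∣addUpTo∣≡ (suc b) (false ∷ U) with addUpTo≡⊤⊎∣addUpTo∣≡ b U
... | inj₁ ≡⊤ = inj₁ (cong (true ∷_) ≡⊤)
... | inj₂ ≡+ = inj₂ (trans (cong suc ≡+) (sym (ℕₚ.+-suc ∣ U ∣ b)))

maxCover : ∀ {n} → ℕ → Subset n → Subset n
maxCover k U = addUpTo (k ∸ ∣ U ∣) U

⊆-maxCover : ∀ {n} k (U : Subset n) → U ⊆ maxCover k U
⊆-maxCover k U = ⊆-addUpTo (k ∸ ∣ U ∣) U

maxCover-isMax : ∀ {n} k (U : Subset n) → ∣ U ∣ ≤ k → IsMax k (maxCover k U)
maxCover-isMax k U ∣U∣≤k = ∣cover∣≤k , maximal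
  where
  ∣U∣+rest≡k : ∣ U ∣ ℕ.+ (k ∸ ∣ U ∣) ≡ k
  ∣U∣+rest≡k = ℕₚ.m+[n∸m]≡n ∣U∣≤k
  ∣cover∣≤k : InS k (maxCover k U)
  ∣cover∣≤k = ℕₚ.≤-trans (∣addUpTo∣≤ (k ∸ ∣ U ∣) U) (ℕₚ.≤-reflexive ∣U∣+rest≡k)
  maximal : ∀ E → maxCover k U ⊆ E → InS k E → E ≡ maxCover k U
  maximal E cover⊆E ∣E∣≤k with addUpTo≡⊤⊎∣addUpTo∣≡ (k ∸ ∣ U ∣) U
  ... | inj₁ cover≡⊤ = trans (⊆-antisym ⊆⊤ (subst (_⊆ E) cover≡⊤ cover⊆E)) (sym cover≡⊤)
  ... | inj₂ ∣cover∣≡ =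
    ⊆∧∣∣≤⇒≡ cover⊆E (ℕₚ.≤-trans ∣E∣≤k (ℕₚ.≤-reflexive (sym (trans ∣cover∣≡ ∣U∣+rest≡k))))

infixr 9 _∘ₚ_

_∘ₚ_ : PMap NB NC → PMap NA NB → PMap NA NC
g ∘ₚ f = Vec.map (_>>= lookup g) f

img : PMap N M → Subset M
img []            = ∅
img (nothing ∷ f) = img f
img (just b ∷ f)  = ⁅ b ⁆ ∪ img f

dom-restrict : ∀ (h : PMap N M) E → dom (restrict h E) ≡ dom h ∩ E
dom-restrict []            []          = refl
dom-restrict (nothing ∷ h) (true ∷ E)  = cong (false ∷_) (dom-restrict h E)
dom-restrict (nothing ∷ h) (false ∷ E) = cong (false ∷_) (dom-restrict h E)
dom-restrict (just _ ∷ h)  (true ∷ E)  = cong (true ∷_) (dom-restrict h E)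
dom-restrict (just _ ∷ h)  (false ∷ E) = cong (false ∷_) (dom-restrict h E)

dom-restrict-⊆ : ∀ (h : PMap N M) {E} → E ⊆ dom h → dom (restrict h E) ≡ E
dom-restrict-⊆ h {E} E⊆dom = trans (dom-restrict h E) (⊆⇒∩≡ E⊆dom)

restrict-restrict : ∀ (h : PMap N M) E E' → restrict (restrict h E) E' ≡ restrict h (E ∩ E')
restrict-restrict []      []          []           = refl
restrict-restrict (x ∷ h) (true ∷ E)  (true ∷ E')  = cong (x ∷_) (restrict-restrict h E E')
restrict-restrict (x ∷ h) (true ∷ E)  (false ∷ E') = cong (nothing ∷_) (restrict-restrict h E E')
restrict-restrict (x ∷ h) (false ∷ E) (true ∷ E')  = cong (nothing ∷_) (restrict-restrict h E E')
restrict-restrict (x ∷ h) (false ∷ E) (false ∷ E') = cong (nothing ∷_) (restrict-restrict h E E')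

lookup-restrict : ∀ (h : PMap N M) {E b} → b ∈ E → lookup (restrict h E) b ≡ lookup h b
lookup-restrict h {E} {b} b∈E
  rewrite Vecₚ.lookup-zipWith (λ x c → if c then x else nothing) b h E | Vecₚ.[]=⇒lookup b∈E = refl

img-just : ∀ b (f : PMap N M) {U} → img (just b ∷ f) ⊆ U → b ∈ U × img f ⊆ U
img-just b f img⊆U =
  img⊆U (p⊆p∪q (img f) (x∈⁅x⁆ b)) , λ x∈img → img⊆U (q⊆p∪q ⁅ b ⁆ (img f) x∈img)

img-restrict : ∀ (f : PMap N M) E → img (restrict f E) ⊆ img f
img-restrict []            []          = ⊆-refl
img-restrict (nothing ∷ f) (true ∷ E)  = img-restrict f E
img-restrict (nothing ∷ f) (false ∷ E) = img-restrict f E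
img-restrict (just b ∷ f)  (false ∷ E) = ⊆-trans (img-restrict f E) (q⊆p∪q ⁅ b ⁆ (img f))
img-restrict (just b ∷ f)  (true ∷ E)  x∈ with x∈p∪q⁻ ⁅ b ⁆ (img (restrict f E)) x∈
... | inj₁ x∈⁅b⁆ = p⊆p∪q (img f) x∈⁅b⁆
... | inj₂ x∈img = q⊆p∪q ⁅ b ⁆ (img f) (img-restrict f E x∈img)

img-restrict-∅ : ∀ (f : PMap N M) → img (restrict f ∅) ≡ ∅
img-restrict-∅ []      = refl
img-restrict-∅ (x ∷ f) = img-restrict-∅ f

∣img∣≤∣dom∣ : ∀ (f : PMap N M) → ∣ img f ∣ ≤ ∣ dom f ∣
∣img∣≤∣dom∣ {M = M} []   = ℕₚ.≤-reflexive (∣⊥∣≡0 M)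
∣img∣≤∣dom∣ (nothing ∷ f) = ∣img∣≤∣dom∣ f
∣img∣≤∣dom∣ (just b ∷ f)  = ℕₚ.≤-trans (∣⁅x⁆∪p∣≤1+∣p∣ b (img f)) (s≤s (∣img∣≤∣dom∣ f))

∣img∣≤k : ∀ {k D} {f : PMap N M} → InS k D → dom f ≡ D → ∣ img f ∣ ≤ k
∣img∣≤k {f = f} ∣D∣≤k dom≡D =
  ℕₚ.≤-trans (∣img∣≤∣dom∣ f) (subst (λ E → ∣ E ∣ ≤ _) (sym dom≡D) ∣D∣≤k)

restrict-∘ₚ : ∀ (g : PMap NB NC) (f : PMap NA NB) E → restrict (g ∘ₚ f) E ≡ g ∘ₚ restrict f E
restrict-∘ₚ g []      []          = refl
restrict-∘ₚ g (x ∷ f) (true ∷ E)  = cong ((x >>= lookup g) ∷_) (restrict-∘ₚ g f E)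
restrict-∘ₚ g (x ∷ f) (false ∷ E) = cong (nothing ∷_) (restrict-∘ₚ g f E)

restrict-img-∘ₚ : ∀ (g : PMap NB NC) (f : PMap NA NB) {U} → img f ⊆ U → restrict g U ∘ₚ f ≡ g ∘ₚ f
restrict-img-∘ₚ g []            img⊆U = refl
restrict-img-∘ₚ g (nothing ∷ f) img⊆U = cong (nothing ∷_) (restrict-img-∘ₚ g f img⊆U)
restrict-img-∘ₚ g (just b ∷ f)  img⊆U =
  cong₂ _∷_ (lookup-restrict g b∈U) (restrict-img-∘ₚ g f imgf⊆U)
  where
  b∈U = proj₁ (img-just b f img⊆U)
  imgf⊆U = proj₂ (img-just b f img⊆U)

dom-∘ₚ : ∀ (g : PMap NB NC) (f : PMap NA NB) → img f ⊆ dom g → dom (g ∘ₚ f) ≡ dom f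
dom-∘ₚ g []            img⊆dom = refl
dom-∘ₚ g (nothing ∷ f) img⊆dom = cong (false ∷_) (dom-∘ₚ g f img⊆dom)
dom-∘ₚ g (just b ∷ f)  img⊆dom = cong₂ _∷_ b∈dom (dom-∘ₚ g f (proj₂ (img-just b f img⊆dom)))
  where
  b∈dom : is-just (lookup g b) ≡ true
  b∈dom = trans (sym (Vecₚ.lookup-map b is-just g)) (Vecₚ.[]=⇒lookup (proj₁ (img-just b f img⊆dom)))

restrict-dom-restrict : ∀ {M'} (g' : PMap N M) {g : PMap N M'} {E} → E ⊆ dom g →
  restrict g' (dom (restrict g E)) ≡ restrict g' E
restrict-dom-restrict g' {g} E⊆dom = cong (restrict g') (dom-restrict-⊆ g E⊆dom)

img-⊆-extension : ∀ {f f' : PMap N M} {E} → restrict f' E ≡ f → img f ⊆ img f'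
img-⊆-extension {f' = f'} {E} f'|≡f = subst (λ r → img r ⊆ img f') f'|≡f (img-restrict f' E)

restrict-∘ₚ-extension : ∀ {f f' : PMap NA NB} {g g' : PMap NB NC} →
  restrict f' (dom f) ≡ f → restrict g' (img f) ≡ restrict g (img f) →
  restrict (g' ∘ₚ f') (dom f) ≡ g ∘ₚ f
restrict-∘ₚ-extension {f = f} {f'} {g} {g'} f'|≡f g'|≡g| = begin
    restrict (g' ∘ₚ f') (dom f)  ≡⟨ restrict-∘ₚ g' f' (dom f) ⟩
    g' ∘ₚ restrict f' (dom f)    ≡⟨ cong (g' ∘ₚ_) f'|≡f ⟩
    g' ∘ₚ f                      ≡⟨ sym (restrict-img-∘ₚ g' f ⊆-refl) ⟩
    restrict g' (img f) ∘ₚ f     ≡⟨ cong (_∘ₚ f) g'|≡g| ⟩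
    restrict g (img f) ∘ₚ f      ≡⟨ restrict-img-∘ₚ g f ⊆-refl ⟩
    g ∘ₚ f                       ∎
  where open ≡-Reasoning

bind-just : ∀ (g : PMap NB NC) x {c} → (x >>= lookup g) ≡ just c →
  ∃ λ b → x ≡ just b × lookup g b ≡ just c
bind-just g (just b) eq = b , refl , eq

lookup-∘ₚ-factor : ∀ {n} (g : PMap NB NC) (f : PMap NA NB) (t : Vec (Fin NA) n) (u : Vec (Fin NC) n) →
  Vec.map (lookup (g ∘ₚ f)) t ≡ Vec.map just u →
  ∃ λ v → Vec.map (lookup f) t ≡ Vec.map just v × Vec.map (lookup g) v ≡ Vec.map just u
lookup-∘ₚ-factor g f []      []      eq = [] , refl , refl
lookup-∘ₚ-factor g f (i ∷ t) (c ∷ u) eq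
  with bind-just g (lookup f i) (trans (sym (Vecₚ.lookup-map i (_>>= lookup g) f)) (Vecₚ.∷-injectiveˡ eq))
     | lookup-∘ₚ-factor g f t u (Vecₚ.∷-injectiveʳ eq)
... | b , fi≡b , gb≡c | v , ft≡v , gv≡u = b ∷ v , cong₂ _∷_ fi≡b ft≡v , cong₂ _∷_ gb≡c gv≡u

IsHom-∘ₚ : ∀ {σ} {X : Structure σ NA} {Y : Structure σ NB} {Z : Structure σ NC} {f g} →
  IsHom X Y f → IsHom Y Z g → IsHom X Z (g ∘ₚ f)
IsHom-∘ₚ {f = f} {g} f-hom g-hom R t u gft≡u Xt with lookup-∘ₚ-factor g f t u gft≡u
... | v , ft≡v , gv≡u = g-hom R v u gv≡u (f-hom R t v ft≡v Xt)

Hk-∘ₚ : ∀ {σ} k {X : Structure σ NA} {Y : Structure σ NB} {Z : Structure σ NC} {f g} →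
  img f ⊆ dom g → Hk k X Y f → Hk k Y Z g → Hk k X Z (g ∘ₚ f)
Hk-∘ₚ k {f = f} {g} img⊆dom (∣f∣≤k , f-hom) (_ , g-hom) =
  subst (InS k) (sym (dom-∘ₚ g f img⊆dom)) ∣f∣≤k , IsHom-∘ₚ {f = f} {g} f-hom g-hom

-- The coefficient of y in ∑_{z ∈ l} W z · Q z; push c E is, definitionally,
-- the special case pushAlong (allPMaps N M) (λ h → restrict h E) c.
pushAlong : ∀ {Z : Set} → List Z → (Z → PMap N M) → (Z → ℤ) → PMap N M → ℤ
pushAlong l Q W y = ∑[ z ∈ l ] ⟦ does (Q z ≟ᵖ y) ⟧* W z

pushAlong≢0 : ∀ {Z : Set} (l : List Z) (Q : Z → PMap N M) W y →
  pushAlong l Q W y ≢ 0ℤ → ∃ λ z → Q z ≡ y × W z ≢ 0ℤ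
pushAlong≢0 l Q W y ne with Any.satisfied (sum≢0⇒Any l (λ z → ⟦ does (Q z ≟ᵖ y) ⟧* W z) ne)
... | z , ne′ = z , iverson≢0 (Q z ≟ᵖ y) (W z) ne′

pushAlong-cong : ∀ {Z : Set} (l : List Z) {Q Q' : Z → PMap N M} {W W' : Z → ℤ} →
  (∀ z → Q z ≡ Q' z) → (∀ z → W z ≡ W' z) → ∀ y → pushAlong l Q W y ≡ pushAlong l Q' W' y
pushAlong-cong l Q≗Q' W≗W' y =
  sum-cong l (λ z → cong₂ (λ q w → ⟦ does (q ≟ᵖ y) ⟧* w) (Q≗Q' z) (W≗W' z))

pushAlong-δ : ∀ (P : PMap N M → PMap NA NB) p y →
  pushAlong (allPMaps N M) P (λ x → ⟦ does (x ≟ᵖ p) ⟧* 1ℤ) y ≡ ⟦ does (P p ≟ᵖ y) ⟧* 1ℤ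
pushAlong-δ {N = N} {M = M} P p y =
  trans (sum-cong (allPMaps N M) (λ x → iverson-comm (does (P x ≟ᵖ y)) (does (x ≟ᵖ p)) 1ℤ))
        (allPMaps-enumerates N M (λ x → ⟦ does (P x ≟ᵖ y) ⟧* 1ℤ) p)

pushAlong-∘ : ∀ {Z : Set} (l : List Z) (P : PMap N M → PMap NA NB) (Q : Z → PMap N M) W y →
  pushAlong (allPMaps N M) P (pushAlong l Q W) y ≡ pushAlong l (P ∘ Q) W y
pushAlong-∘ {N = N} {M = M} l P Q W y = begin
    ∑[ x ∈ allPMaps N M ] ⟦ does (P x ≟ᵖ y) ⟧* (∑[ z ∈ l ] ⟦ does (Q z ≟ᵖ x) ⟧* W z)
  ≡⟨ sum-cong (allPMaps N M) (λ x →
       trans (iverson-sum l (does (P x ≟ᵖ y)) _)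
             (sum-cong l (λ z → iverson-comm (does (P x ≟ᵖ y)) (does (Q z ≟ᵖ x)) (W z)))) ⟩
    ∑[ x ∈ allPMaps N M ] (∑[ z ∈ l ] ⟦ does (Q z ≟ᵖ x) ⟧* ⟦ does (P x ≟ᵖ y) ⟧* W z)
  ≡⟨ sum-swap (allPMaps N M) l (λ x z → ⟦ does (Q z ≟ᵖ x) ⟧* ⟦ does (P x ≟ᵖ y) ⟧* W z) ⟩
    ∑[ z ∈ l ] (∑[ x ∈ allPMaps N M ] ⟦ does (Q z ≟ᵖ x) ⟧* ⟦ does (P x ≟ᵖ y) ⟧* W z)
  ≡⟨ sum-cong l (λ z →
       allPMaps-enumerates-sym N M (λ x → ⟦ does (P x ≟ᵖ y) ⟧* W z) (Q z)) ⟩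
    ∑[ z ∈ l ] ⟦ does (P (Q z) ≟ᵖ y) ⟧* W z ∎
  where open ≡-Reasoning

pushAlong-linear : ∀ {Z : Set} (l : List Z) (P : PMap N M → PMap NA NB)
  (a : Z → ℤ) (Φ : Z → PMap N M → ℤ) y →
  pushAlong (allPMaps N M) P (λ x → ∑[ z ∈ l ] a z * Φ z x) y
    ≡ ∑[ z ∈ l ] a z * pushAlong (allPMaps N M) P (Φ z) y
pushAlong-linear {N = N} {M = M} l P a Φ y = begin
    ∑[ x ∈ allPMaps N M ] ⟦ does (P x ≟ᵖ y) ⟧* (∑[ z ∈ l ] a z * Φ z x)
  ≡⟨ sum-cong (allPMaps N M) (λ x → iverson-sum l (does (P x ≟ᵖ y)) (λ z → a z * Φ z x)) ⟩
    ∑[ x ∈ allPMaps N M ] (∑[ z ∈ l ] ⟦ does (P x ≟ᵖ y) ⟧* (a z * Φ z x))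
  ≡⟨ sum-swap (allPMaps N M) l (λ x z → ⟦ does (P x ≟ᵖ y) ⟧* (a z * Φ z x)) ⟩
    ∑[ z ∈ l ] (∑[ x ∈ allPMaps N M ] ⟦ does (P x ≟ᵖ y) ⟧* (a z * Φ z x))
  ≡⟨ sum-cong l (λ z →
       trans (sum-cong (allPMaps N M) (λ x → iverson-*ˡ (does (P x ≟ᵖ y)) (a z) (Φ z x)))
             (sum-*ˡ (allPMaps N M) (a z) (λ x → ⟦ does (P x ≟ᵖ y) ⟧* Φ z x))) ⟩
    ∑[ z ∈ l ] a z * pushAlong (allPMaps N M) P (Φ z) y ∎
  where open ≡-Reasoning

sum-*-pushAlong : ∀ {Z : Set} (l : List Z) (Q : Z → PMap N M) (a : Z → ℤ) (Φ : PMap N M → ℤ) →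
  ∑[ z ∈ l ] a z * Φ (Q z) ≡ ∑[ x ∈ allPMaps N M ] pushAlong l Q a x * Φ x
sum-*-pushAlong {N = N} {M = M} l Q a Φ = sym (begin
    ∑[ x ∈ allPMaps N M ] pushAlong l Q a x * Φ x
  ≡⟨ sum-cong (allPMaps N M) (λ x → sym (sum-*ʳ l (Φ x) (λ z → ⟦ does (Q z ≟ᵖ x) ⟧* a z))) ⟩
    ∑[ x ∈ allPMaps N M ] (∑[ z ∈ l ] ⟦ does (Q z ≟ᵖ x) ⟧* a z * Φ x)
  ≡⟨ sum-cong (allPMaps N M) (λ x → sum-cong l (λ z → iverson-*ʳ (does (Q z ≟ᵖ x)) (a z) (Φ x))) ⟩
    ∑[ x ∈ allPMaps N M ] (∑[ z ∈ l ] ⟦ does (Q z ≟ᵖ x) ⟧* (a z * Φ x))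
  ≡⟨ sum-swap (allPMaps N M) l (λ x z → ⟦ does (Q z ≟ᵖ x) ⟧* (a z * Φ x)) ⟩
    ∑[ z ∈ l ] (∑[ x ∈ allPMaps N M ] ⟦ does (Q z ≟ᵖ x) ⟧* (a z * Φ x))
  ≡⟨ sum-cong l (λ z → allPMaps-enumerates-sym N M (λ x → a z * Φ x) (Q z)) ⟩
    ∑[ z ∈ l ] a z * Φ (Q z) ∎)
  where open ≡-Reasoning

push-∩ : ∀ (c : PMap N M → ℤ) E E' g → push (push c E) E' g ≡ push c (E ∩ E') g
push-∩ {N = N} {M = M} c E E' g =
  trans (pushAlong-∘ (allPMaps N M) (λ x → restrict x E') (λ x → restrict x E) c g)
        (pushAlong-cong (allPMaps N M) (λ z → restrict-restrict z E E') (λ _ → refl) g)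

push-cong : ∀ {c c' : PMap N M → ℤ} E → (∀ x → c x ≡ c' x) → ∀ g → push c E g ≡ push c' E g
push-cong {N = N} {M = M} E c≗c' = pushAlong-cong (allPMaps N M) {Q = λ x → restrict x E} (λ _ → refl) c≗c'

push-⊆ : ∀ (c : PMap N M → ℤ) {E E'} → E' ⊆ E → ∀ g → push (push c E) E' g ≡ push c E' g
push-⊆ c {E} {E'} E'⊆E g = trans (push-∩ c E E' g) (cong (λ F → push c F g) (⊆⇒∩≡ E'⊆E))

-- The support and compatibility conditions on a ℤ-test witness: the first
-- two components of ZTest.
Supported : ℕ → Family N M → (Subset N → PMap N M → ℤ) → Set
Supported k P α = ∀ D → IsMax k D → ∀ h → α D h ≢ 0ℤ → dom h ≡ D × P h

Compatible : ℕ → (Subset N → PMap N M → ℤ) → Set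
Compatible {N = N} {M = M} k α = ∀ D D' → IsMax k D → IsMax k D' → ∀ (g : PMap N M) →
  push (α D) (D ∩ D') g ≡ push (α D') (D ∩ D') g

compatible-⊆ : ∀ {k} {α : Subset N → PMap N M → ℤ} → Compatible k α →
  ∀ {D D' E} → IsMax k D → IsMax k D' → E ⊆ D ∩ D' → ∀ g → push (α D) E g ≡ push (α D') E g
compatible-⊆ {α = α} α-compat {D} {D'} {E} D-max D'-max E⊆D∩D' g = begin
    push (α D) E g                    ≡⟨ sym (push-⊆ (α D) E⊆D∩D' g) ⟩
    push (push (α D) (D ∩ D')) E g    ≡⟨ push-cong E (α-compat D D' D-max D'-max) g ⟩
    push (push (α D') (D ∩ D')) E g   ≡⟨ push-⊆ (α D') E⊆D∩D' g ⟩
    push (α D') E g                   ∎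
  where open ≡-Reasoning

module ZTestComposition {NA NB NC : ℕ} (k : ℕ)
  (PAB : Family NA NB) (PBC : Family NB NC) (PAC : Family NA NC)
  (∘ₚ-closed : ∀ f g → PAB f → PBC g → img f ⊆ dom g → PAC (g ∘ₚ f))
  (restrict-closed : ∀ g E → E ⊆ dom g → PBC g → PBC (restrict g E)) where

  module Postcompose (β : Subset NB → PMap NB NC → ℤ)
                     (β-supp : Supported k PBC β) (β-compat : Compatible k β) where

    -- β extended from M_k(B) to all of S_k(B)
    βᵤ : Subset NB → PMap NB NC → ℤ
    βᵤ U = push (β (maxCover k U)) U

    βᵤ-restrict : ∀ {U U'} → ∣ U ∣ ≤ k → U' ⊆ U → ∀ g → βᵤ U' g ≡ push (βᵤ U) U' g
    βᵤ-restrict {U} {U'} ∣U∣≤k U'⊆U g = begin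
        push (β (maxCover k U')) U' g   ≡⟨ sym (compatible-⊆ β-compat cover-max cover'-max U'⊆covers g) ⟩
        push (β (maxCover k U)) U' g    ≡⟨ sym (push-⊆ (β (maxCover k U)) U'⊆U g) ⟩
        push (βᵤ U) U' g                ∎
      where
      open ≡-Reasoning
      cover-max = maxCover-isMax k U ∣U∣≤k
      cover'-max = maxCover-isMax k U' (ℕₚ.≤-trans (p⊆q⇒∣p∣≤∣q∣ U'⊆U) ∣U∣≤k)
      U'⊆covers : U' ⊆ maxCover k U ∩ maxCover k U'
      U'⊆covers x∈U' = x∈p∩q⁺ (⊆-maxCover k U (U'⊆U x∈U') , ⊆-maxCover k U' x∈U')

    composite : PMap NA NB → PMap NA NC → ℤ
    composite f = pushAlong (allPMaps NB NC) (_∘ₚ f) (βᵤ (img f))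

    push-composite : ∀ f → ∣ img f ∣ ≤ k → ∀ E h → push (composite f) E h ≡ composite (restrict f E) h
    push-composite f ∣img∣≤k E h = begin
        push (composite f) E h
      ≡⟨ pushAlong-∘ (allPMaps NB NC) (λ h → restrict h E) (_∘ₚ f) (βᵤ U) h ⟩
        pushAlong (allPMaps NB NC) (λ g → restrict (g ∘ₚ f) E) (βᵤ U) h
      ≡⟨ pushAlong-cong (allPMaps NB NC) {Q = λ g → restrict (g ∘ₚ f) E} restrict-composite (λ _ → refl) h ⟩
        pushAlong (allPMaps NB NC) (λ g → restrict g U' ∘ₚ e) (βᵤ U) h
      ≡⟨ sym (pushAlong-∘ (allPMaps NB NC) (_∘ₚ e) (λ g → restrict g U') (βᵤ U) h) ⟩
        pushAlong (allPMaps NB NC) (_∘ₚ e) (push (βᵤ U) U') h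
      ≡⟨ pushAlong-cong (allPMaps NB NC) {Q = _∘ₚ e} (λ _ → refl)
           (λ g → sym (βᵤ-restrict ∣img∣≤k (img-restrict f E) g)) h ⟩
        composite e h ∎
      where
      open ≡-Reasoning
      U = img f
      e = restrict f E
      U' = img e
      restrict-composite : ∀ g → restrict (g ∘ₚ f) E ≡ restrict g U' ∘ₚ e
      restrict-composite g = trans (restrict-∘ₚ g f E) (sym (restrict-img-∘ₚ g e ⊆-refl))

    composite-supp : ∀ f h → ∣ img f ∣ ≤ k → composite f h ≢ 0ℤ →
      ∃ λ g → g ∘ₚ f ≡ h × PBC g × img f ⊆ dom g
    composite-supp f h ∣img∣≤k ne with pushAlong≢0 (allPMaps NB NC) (_∘ₚ f) (βᵤ (img f)) h ne
    ... | g , g∘f≡h , βᵤg≢0 with pushAlong≢0 (allPMaps NB NC) (λ x → restrict x (img f)) _ g βᵤg≢0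
    ... | x , x|≡g , βx≢0 with β-supp (maxCover k (img f)) (maxCover-isMax k (img f) ∣img∣≤k) x βx≢0
    ... | dom≡cover , PBCx = g , g∘f≡h , subst PBC x|≡g (restrict-closed x (img f) img⊆dom PBCx) , img⊆dom-g
      where
      img⊆dom : img f ⊆ dom x
      img⊆dom = subst (img f ⊆_) (sym dom≡cover) (⊆-maxCover k (img f))
      img⊆dom-g : img f ⊆ dom g
      img⊆dom-g = subst (img f ⊆_) (trans (sym (dom-restrict-⊆ x img⊆dom)) (cong dom x|≡g)) ⊆-refl

    composed : (Subset NA → PMap NA NB → ℤ) → Subset NA → PMap NA NC → ℤ
    composed α D h = ∑[ f ∈ allPMaps NA NB ] α D f * composite f h

    module _ {α : Subset NA → PMap NA NB → ℤ} (α-supp : Supported k PAB α) where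

      push-composed : ∀ D → IsMax k D → ∀ E h →
        push (composed α D) E h ≡ ∑[ e ∈ allPMaps NA NB ] push (α D) E e * composite e h
      push-composed D D-max E h = begin
          push (composed α D) E h
        ≡⟨ pushAlong-linear (allPMaps NA NB) (λ h → restrict h E) (α D) composite h ⟩
          ∑[ f ∈ allPMaps NA NB ] α D f * push (composite f) E h
        ≡⟨ sum-*-cong-on-support (allPMaps NA NB) (α D) _ _ (λ f αf≢0 →
             push-composite f (∣img∣≤k (proj₁ D-max) (proj₁ (α-supp D D-max f αf≢0))) E h) ⟩
          ∑[ f ∈ allPMaps NA NB ] α D f * composite (restrict f E) h
        ≡⟨ sum-*-pushAlong (allPMaps NA NB) (λ f → restrict f E) (α D) (λ e → composite e h) ⟩
          ∑[ e ∈ allPMaps NA NB ] push (α D) E e * composite e h ∎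
        where open ≡-Reasoning

      composed-compat : Compatible k α → Compatible k (composed α)
      composed-compat α-compat D D' D-max D'-max h = begin
          push (composed α D) (D ∩ D') h
        ≡⟨ push-composed D D-max (D ∩ D') h ⟩
          ∑[ e ∈ allPMaps NA NB ] push (α D) (D ∩ D') e * composite e h
        ≡⟨ sum-cong (allPMaps NA NB) (λ e → cong (_* composite e h) (α-compat D D' D-max D'-max e)) ⟩
          ∑[ e ∈ allPMaps NA NB ] push (α D') (D ∩ D') e * composite e h
        ≡⟨ sym (push-composed D' D'-max (D ∩ D') h) ⟩
          push (composed α D') (D ∩ D') h ∎
        where open ≡-Reasoning

      composed-supp : Supported k PAC (composed α)
      composed-supp D D-max h ne with sum-*≢0 (allPMaps NA NB) (α D) (λ f → composite f h) ne
      ... | f , αf≢0 , composite≢0 with α-supp D D-max f αf≢0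
      ... | dom≡D , PABf with composite-supp f h (∣img∣≤k (proj₁ D-max) dom≡D) composite≢0
      ... | g , g∘f≡h , PBCg , img⊆dom =
        trans (cong dom (sym g∘f≡h)) (trans (dom-∘ₚ g f img⊆dom) dom≡D) ,
        subst PAC g∘f≡h (∘ₚ-closed f g PABf PBCg img⊆dom)

  ZTest-∘ₚ : ∀ {f : PMap NA NB} {g g'' : PMap NB NC} → img f ⊆ dom g → dom g'' ≡ maxCover k (img f) →
    restrict g'' (img f) ≡ restrict g (img f) →
    ZTest k PAB f → ZTest k PBC g'' → ZTest k PAC (g ∘ₚ f)
  ZTest-∘ₚ {f} {g} {g''} img⊆dom dom≡cover g''|≡g|
           (α , α-supp , α-compat , α-δ) (β , β-supp , β-compat , β-δ) =
    composed α , composed-supp α-supp , composed-compat α-supp α-compat , composed-δ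
    where
    open Postcompose β β-supp β-compat
    open ≡-Reasoning

    βᵤ-δ : ∀ g₂ → βᵤ (img f) g₂ ≡ ⟦ does (g₂ ≟ᵖ restrict g (img f)) ⟧* 1ℤ
    βᵤ-δ g₂ = begin
        push (β (maxCover k (img f))) (img f) g₂
      ≡⟨ cong (λ D → push (β D) (img f) g₂) (sym dom≡cover) ⟩
        push (β (dom g'')) (img f) g₂
      ≡⟨ push-cong (img f) β-δ g₂ ⟩
        pushAlong (allPMaps NB NC) (λ x → restrict x (img f)) (λ x → ⟦ does (x ≟ᵖ g'') ⟧* 1ℤ) g₂
      ≡⟨ pushAlong-δ (λ x → restrict x (img f)) g'' g₂ ⟩
        ⟦ does (restrict g'' (img f) ≟ᵖ g₂) ⟧* 1ℤ
      ≡⟨ cong (λ r → ⟦ does (r ≟ᵖ g₂) ⟧* 1ℤ) g''|≡g| ⟩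
        ⟦ does (restrict g (img f) ≟ᵖ g₂) ⟧* 1ℤ
      ≡⟨ cong (⟦_⟧* 1ℤ) (does-≟-sym _≟ᵖ_ (restrict g (img f)) g₂) ⟩
        ⟦ does (g₂ ≟ᵖ restrict g (img f)) ⟧* 1ℤ ∎

    composed-δ : ∀ h → composed α (dom (g ∘ₚ f)) h ≡ ⟦ does (h ≟ᵖ (g ∘ₚ f)) ⟧* 1ℤ
    composed-δ h = begin
        composed α (dom (g ∘ₚ f)) h
      ≡⟨ cong (λ D → composed α D h) (dom-∘ₚ g f img⊆dom) ⟩
        ∑[ f' ∈ allPMaps NA NB ] α (dom f) f' * composite f' h
      ≡⟨ sum-cong (allPMaps NA NB) (λ f' →
           trans (cong (_* composite f' h) (α-δ f')) (iverson-1-* (does (f' ≟ᵖ f)) (composite f' h))) ⟩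
        ∑[ f' ∈ allPMaps NA NB ] ⟦ does (f' ≟ᵖ f) ⟧* composite f' h
      ≡⟨ allPMaps-enumerates NA NB (λ f' → composite f' h) f ⟩
        composite f h
      ≡⟨ pushAlong-cong (allPMaps NB NC) {Q = _∘ₚ f} (λ _ → refl) βᵤ-δ h ⟩
        pushAlong (allPMaps NB NC) (_∘ₚ f) (λ g₂ → ⟦ does (g₂ ≟ᵖ restrict g (img f)) ⟧* 1ℤ) h
      ≡⟨ pushAlong-δ (_∘ₚ f) (restrict g (img f)) h ⟩
        ⟦ does ((restrict g (img f) ∘ₚ f) ≟ᵖ h) ⟧* 1ℤ
      ≡⟨ cong (λ r → ⟦ does (r ≟ᵖ h) ⟧* 1ℤ) (restrict-img-∘ₚ g f ⊆-refl) ⟩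
        ⟦ does ((g ∘ₚ f) ≟ᵖ h) ⟧* 1ℤ
      ≡⟨ cong (⟦_⟧* 1ℤ) (does-≟-sym _≟ᵖ_ (g ∘ₚ f) h) ⟩
        ⟦ does (h ≟ᵖ (g ∘ₚ f)) ⟧* 1ℤ ∎

◇-restrict : ∀ k (P : Family N M) h E → E ⊆ dom h → ◇ k P h → ◇ k P (restrict h E)
◇-restrict k P h E E⊆dom (Q , Q-sub , Q-flasque , Qh) = Q , Q-sub , Q-flasque , proj₂ Q-sub h E E⊆dom Qh

∈-allPMaps : ∀ (p : PMap N M) → Any (p ≡_) (allPMaps N M)
∈-allPMaps {N = N} {M = M} = enumerates-complete _≟ᵖ_ (allPMaps N M) (allPMaps-enumerates N M)

module ◇-Composition {NA NB NC : ℕ} (k : ℕ) (P₁ : Family NA NB) (P₂ : Family NB NC) (P₃ : Family NA NC)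
  (∘ₚ-closed : ∀ Q₁ Q₂ → IsSubPresheaf Q₁ P₁ → IsSubPresheaf Q₂ P₂ → IsFlasque k Q₂ →
               ∀ f g → T (Q₁ f) → T (Q₂ g) → img f ⊆ dom g → P₃ (g ∘ₚ f)) where

  module Composites (Q₁ : PMap NA NB → Bool) (Q₂ : PMap NB NC → Bool)
    (Q₁-sub : IsSubPresheaf Q₁ P₁) (Q₁-flasque : IsFlasque k Q₁)
    (Q₂-sub : IsSubPresheaf Q₂ P₂) (Q₂-flasque : IsFlasque k Q₂) where

    Composable : PMap NA NC → PMap NA NB → PMap NB NC → Set
    Composable h f g = T (Q₁ f) × T (Q₂ g) × img f ⊆ dom g × g ∘ₚ f ≡ h

    composable? : ∀ h f g → Dec (Composable h f g)
    composable? h f g = T? (Q₁ f) ×-dec T? (Q₂ g) ×-dec (img f ⊆? dom g) ×-dec ((g ∘ₚ f) ≟ᵖ h)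

    -- A subpresheaf is a characteristic function, so the composites are found
    -- by exhaustive search over all pairs.
    composites? : ∀ h → Dec (Any (λ f → Any (Composable h f) (allPMaps NB NC)) (allPMaps NA NB))
    composites? h = any? (λ f → any? (composable? h f) (allPMaps NB NC)) (allPMaps NA NB)

    composites : PMap NA NC → Bool
    composites h = isYes (composites? h)

    composites-elim : ∀ h → T (composites h) → ∃ λ f → ∃ λ g → Composable h f g
    composites-elim h t with Any.satisfied (toWitness {a? = composites? h} t)
    ... | f , g-any with Any.satisfied g-any
    ... | g , c = f , g , c

    composites-intro : ∀ {h f g} → Composable h f g → T (composites h)
    composites-intro {h} {f} {g} c =
      fromWitness {a? = composites? h}
        (Any.map (λ { refl → Any.map (λ { refl → c }) (∈-allPMaps g) }) (∈-allPMaps f))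

    composites-sub : IsSubPresheaf composites P₃
    composites-sub = in-P₃ , restriction-closed
      where
      in-P₃ : ∀ h → T (composites h) → P₃ h
      in-P₃ h t with composites-elim h t
      ... | f , g , Q₁f , Q₂g , img⊆dom , refl =
        ∘ₚ-closed Q₁ Q₂ Q₁-sub Q₂-sub Q₂-flasque f g Q₁f Q₂g img⊆dom
      restriction-closed : ∀ h E → E ⊆ dom h → T (composites h) → T (composites (restrict h E))
      restriction-closed h E E⊆dom t with composites-elim h t
      ... | f , g , Q₁f , Q₂g , img⊆dom , refl =
        composites-intro (proj₂ Q₁-sub f E (subst (E ⊆_) (dom-∘ₚ g f img⊆dom) E⊆dom) Q₁f , Q₂g ,
                          ⊆-trans (img-restrict f E) img⊆dom , sym (restrict-∘ₚ g f E))

    extend-composite : ∀ {f g} D → InS k D → dom f ⊆ D → T (Q₁ f) → T (Q₂ g) → img f ⊆ dom g →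
      ∃ λ h → dom h ≡ D × T (composites h) × restrict h (dom f) ≡ g ∘ₚ f
    extend-composite {f} {g} D ∣D∣≤k dom⊆D Q₁f Q₂g img⊆dom
      with Q₁-flasque f D ∣D∣≤k dom⊆D Q₁f
    ... | f' , dom-f'≡D , Q₁f' , f'|≡f
      with Q₂-flasque (restrict g (img f)) (img f') (∣img∣≤k {f = f'} ∣D∣≤k dom-f'≡D)
             (subst (_⊆ img f') (sym (dom-restrict-⊆ g img⊆dom)) (img-⊆-extension f'|≡f))
             (proj₂ Q₂-sub g (img f) img⊆dom Q₂g)
    ... | g' , dom-g'≡img , Q₂g' , g'|≡g| =
      g' ∘ₚ f' , trans (dom-∘ₚ g' f' img⊆dom') dom-f'≡D ,
      composites-intro (Q₁f' , Q₂g' , img⊆dom' , refl) ,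
      restrict-∘ₚ-extension f'|≡f (trans (sym (restrict-dom-restrict g' {g} img⊆dom)) g'|≡g|)
      where
      img⊆dom' : img f' ⊆ dom g'
      img⊆dom' = subst (img f' ⊆_) (sym dom-g'≡img) ⊆-refl

    composites-flasque : IsFlasque k composites
    composites-flasque h D ∣D∣≤k dom⊆D t with composites-elim h t
    ... | f , g , Q₁f , Q₂g , img⊆dom , refl
      with extend-composite D ∣D∣≤k (subst (_⊆ D) (dom-∘ₚ g f img⊆dom) dom⊆D) Q₁f Q₂g img⊆dom
    ... | h' , dom≡D , t' , h'|≡ =
      h' , dom≡D , t' , subst (λ E → restrict h' E ≡ g ∘ₚ f) (sym (dom-∘ₚ g f img⊆dom)) h'|≡

  ◇-∘ₚ : ∀ f g → ◇ k P₁ f → ◇ k P₂ g → img f ⊆ dom g → ◇ k P₃ (g ∘ₚ f)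
  ◇-∘ₚ f g (Q₁ , Q₁-sub , Q₁-flasque , Q₁f) (Q₂ , Q₂-sub , Q₂-flasque , Q₂g) img⊆dom =
    composites , composites-sub , composites-flasque , composites-intro (Q₁f , Q₂g , img⊆dom , refl)
    where open Composites Q₁ Q₂ Q₁-sub Q₁-flasque Q₂-sub Q₂-flasque

module _ {σ : Vocabulary} (k : ℕ) where

  Sm-restrict : ∀ (X : Structure σ N) (Y : Structure σ M) m h E →
    E ⊆ dom h → Sm k X Y m h → Sm k X Y m (restrict h E)
  Sm-restrict X Y zero    = ◇-restrict k (Hk k X Y)
  Sm-restrict X Y (suc m) = ◇-restrict k (□ k (Sm k X Y m))

  module _ {NA NB NC : ℕ} (A : Structure σ NA) (B : Structure σ NB) (C : Structure σ NC) where

    □-∘ₚ-closed : ∀ m → (∀ f g → Sm k A B m f → Sm k B C m g → img f ⊆ dom g → Sm k A C m (g ∘ₚ f)) →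
      ∀ Q₁ Q₂ → IsSubPresheaf Q₁ (□ k (Sm k A B m)) → IsSubPresheaf Q₂ (□ k (Sm k B C m)) →
      IsFlasque k Q₂ →
      ∀ f g → T (Q₁ f) → T (Q₂ g) → img f ⊆ dom g → □ k (Sm k A C m) (g ∘ₚ f)
    □-∘ₚ-closed m Sm-∘ₚ Q₁ Q₂ Q₁-sub Q₂-sub Q₂-flasque f g Q₁f Q₂g img⊆dom =
      Sm-∘ₚ f g (proj₁ (proj₁ Q₁-sub f Q₁f)) (proj₁ (proj₁ Q₂-sub g Q₂g)) img⊆dom , ztest
      where
      open ZTestComposition k (Sm k A B m) (Sm k B C m) (Sm k A C m) Sm-∘ₚ (Sm-restrict B C m)
      ztest : IsMax k (dom (g ∘ₚ f)) → ZTest k (Sm k A C m) (g ∘ₚ f)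
      ztest g∘f-max = ztest-from (subst (IsMax k) (dom-∘ₚ g f img⊆dom) g∘f-max)
        where
        cover-max : IsMax k (dom f) → IsMax k (maxCover k (img f))
        cover-max f-max = maxCover-isMax k (img f) (∣img∣≤k {f = f} (proj₁ f-max) refl)
        ztest-from : IsMax k (dom f) → ZTest k (Sm k A C m) (g ∘ₚ f)
        ztest-from f-max
          with Q₂-flasque (restrict g (img f)) (maxCover k (img f)) (proj₁ (cover-max f-max))
                 (subst (_⊆ maxCover k (img f)) (sym (dom-restrict-⊆ g img⊆dom)) (⊆-maxCover k (img f)))
                 (proj₂ Q₂-sub g (img f) img⊆dom Q₂g)
        ... | g'' , dom≡cover , Q₂g'' , g''|≡g| =
          ZTest-∘ₚ {f} {g} {g''} img⊆dom dom≡cover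
            (trans (sym (restrict-dom-restrict g'' {g} img⊆dom)) g''|≡g|)
            (proj₂ (proj₁ Q₁-sub f Q₁f) f-max)
            (proj₂ (proj₁ Q₂-sub g'' Q₂g'') (subst (IsMax k) (sym dom≡cover) (cover-max f-max)))

    Sm-∘ₚ : ∀ m f g → Sm k A B m f → Sm k B C m g → img f ⊆ dom g → Sm k A C m (g ∘ₚ f)
    Sm-∘ₚ zero    = ◇-Composition.◇-∘ₚ k (Hk k A B) (Hk k B C) (Hk k A C)
      (λ Q₁ Q₂ Q₁-sub Q₂-sub _ f g Q₁f Q₂g img⊆dom →
         Hk-∘ₚ k {f = f} {g} img⊆dom (proj₁ Q₁-sub f Q₁f) (proj₁ Q₂-sub g Q₂g))
    Sm-∘ₚ (suc m) = ◇-Composition.◇-∘ₚ k _ _ _ (□-∘ₚ-closed m (Sm-∘ₚ m))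

proposition10p4 : (σ : Vocabulary) (k : ℕ) → maxArity σ ≤ k →
    ∀ {NA NB NC} (A : Structure σ NA) (B : Structure σ NB) (C : Structure σ NC) →
    A →ℤ[ k ] B → B →ℤ[ k ] C → A →ℤ[ k ] C
proposition10p4 σ k _ A B C (f , f∈S*) (g , g∈S*) =
  g ∘ₚ f∅ , λ m →
    Sm-∘ₚ k A B C m f∅ g (Sm-restrict k A B m f ∅ (⊆-min (dom f)) (f∈S* m)) (g∈S* m) img⊆dom
  where
  f∅ = restrict f ∅
  img⊆dom : img f∅ ⊆ dom g
  img⊆dom = subst (_⊆ dom g) (sym (img-restrict-∅ f)) (⊆-min (dom g))
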